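{- Let $G=(V,E,s,t,v_0)$ be a pointed directed multigraph in which every vertex has only finitely many outgoing edges. Then its coalgebra of rooted paths $(\bar E,d,\varepsilon)$ is a tree as a pointed $\mathcal{B}$-coalgebra.
   Context: $\mathcal{B}\colon\mathsf{Set}\to\mathsf{Set}$ is the bag functor: $\mathcal{B}X=\{m\colon X\to\mathbb{N}\mid m(x)=0$ for all but finitely many $x\}$, $\mathcal{B}f(m)(y)=\sum_{x:f(x)=y}m(x)$. A pointed directed multigraph has vertex set $V$, edge set $E$, source and target maps $s,t\colon E\to V$ and root $v_0\in V$. A path from $u$ to $v$ is a finite sequence $(e_1,\dots,e_n)$ of edges ($n\ge0$) with $s(e_1)=u$, $t(e_{k-1})=s(e_k)$, $t(e_n)=v$ (the empty sequence being a path from $u$ to $u$). The coalgebra of rooted paths: $\bar E$ is the set of all paths starting at $v_0$, $d\colon\bar E\to\mathcal{B}\bar E$ with $d(p)(p')=1$ if $p'=(p,e)$ for some edge $e\in E$ and $0$ otherwise, point the empty path $\varepsilon$. Pointed $\mathcal{B}$-coalgebras in $\mathsf{Set}$ are $(X,x,x_0)$ with $x\colon X\to\mathcal{B}X$ and $x_0\in X$; a pointed coalgebra morphism $h$ satisfies $y\cdot h=\mathcal{B}h\cdot x$ and preserves the point; it is a split epimorphism of pointed coalgebras if some pointed coalgebra morphism $s$ has $h\cdot s=\mathrm{id}$. A pointed coalgebra is a tree if every pointed coalgebra morphism into it is a split epimorphism of pointed coalgebras. -}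

module Defs where

open import Data.List using (List; map)
open import Data.List.Membership.Propositional using (_∈_; mapWith∈)
open import Data.List.Relation.Unary.Unique.Propositional using (Unique)
open import Data.List.Relation.Binary.Permutation.Propositional using (_↭_)
open import Data.Product using (Σ; _×_; _,_; proj₁; proj₂)
open import Function.Bundles using (_⇔_; Equivalence)
open import Relation.Binary.PropositionalEquality using (_≡_; subst; sym)

-- Bag functor B: a finite multiset over X is a list of elements of X
-- considered up to permutation (_↭_); B f = map f.
Bag : Set → Set
Bag X = List X

record PCoalg : Set₁ where
  field
    Carrier : Set
    str     : Carrier → Bag Carrier
    pt      : Carrier
open PCoalg public

IsPMorphism : (C D : PCoalg) → (Carrier C → Carrier D) → Set
IsPMorphism C D h =
  (∀ x → str D (h x) ↭ map h (str C x)) × (h (pt C) ≡ pt D)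

IsSplitEpi : (C D : PCoalg) → (Carrier C → Carrier D) → Set
IsSplitEpi C D h =
  Σ (Carrier D → Carrier C) λ s → IsPMorphism D C s × (∀ y → h (s y) ≡ y)

IsTree : PCoalg → Set₁
IsTree D = (C : PCoalg) (h : Carrier C → Carrier D) →
           IsPMorphism C D h → IsSplitEpi C D h

record Graph : Set₁ where
  field
    V    : Set
    E    : Set
    src  : E → V
    tgt  : E → V
    root : V
open Graph public

FinitelyBranching : Graph → Set
FinitelyBranching G =
  (v : V G) → Σ (List (E G)) λ L → Unique L × (∀ e → (e ∈ L) ⇔ (src G e ≡ v))

module _ (G : Graph) where
  data Path : V G → Set where
    ε    : Path (root G)
    snoc : (e : E G) → Path (src G e) → Path (tgt G e)

  RootedPath : Set
  RootedPath = Σ (V G) Path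

-- The coalgebra of rooted paths (Ē, d, ε): d(p) is the bag containing each
-- one-edge extension (p, e) exactly once.
pathCoalg : (G : Graph) → FinitelyBranching G → PCoalg
pathCoalg G fb = record
  { Carrier = RootedPath G
  ; str     = d
  ; pt      = (root G , ε)
  }
  where
  d : RootedPath G → Bag (RootedPath G)
  d (v , p) = mapWith∈ (proj₁ (fb v)) λ {e} e∈L →
    (tgt G e , snoc e (subst (Path G) (sym (Equivalence.to (proj₂ (proj₂ (fb v)) e) e∈L)) p))

{-# OPTIONS --safe #-}
-- Given a pointed morphism h : C → Ē, a section is built by induction on
-- paths: the root goes to the point of C, and since h commutes with the
-- structures, the successor (p, e) of h c = p is the image of some successor
-- of c, which is chosen as the value at (p, e). This section is a coalgebra
-- morphism because the bag d(p) has no repeated elements, so h is injective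
-- on the successors of the chosen preimage of p.
module Submission where

open import Defs
open import Data.List using (List; map)
import Data.List.Relation.Unary.All as All
open import Data.List.Relation.Unary.AllPairs using (_∷_)
open import Data.List.Relation.Unary.Any using (here; there)
open import Data.List.Membership.Propositional using (_∈_; mapWith∈)
open import Data.List.Membership.Propositional.Properties
  using (∈-map⁺; ∈-map⁻; map-mapWith∈; mapWith∈≗map)
open import Data.List.Relation.Unary.Any.Properties using (mapWith∈⁺; mapWith∈⁻)
open import Data.List.Relation.Unary.Unique.Propositional using (Unique)
import Data.List.Relation.Unary.Unique.Propositional.Properties as Unique
open import Data.List.Relation.Binary.Permutation.Propositional
  using (_↭_; ↭-sym; ↭⇒↭ₛ; module PermutationReasoning)
open import Data.List.Relation.Binary.Permutation.Propositional.Properties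
  using (∈-resp-↭; map⁺)
open import Data.List.Relation.Binary.Permutation.Setoid.Properties using (Unique-resp-↭)
open import Data.List.Properties using (map-id-local; map-∘)
open import Data.Maybe using (Maybe; just; nothing)
open import Data.Maybe.Properties using (just-injective)
open import Data.Product using (Σ; ∃; _×_; _,_; proj₁; proj₂)
open import Data.Product.Properties using (Σ-≡,≡→≡)
open import Data.Empty using (⊥-elim)
open import Function using (_∘_)
open import Function.Bundles using (Equivalence)
open import Relation.Binary.PropositionalEquality
  using (_≡_; refl; sym; trans; cong; subst; setoid; module ≡-Reasoning)
open import Relation.Binary.PropositionalEquality.Properties using (subst-subst-sym)

Unique-map⇒∈-injective : ∀ {A B : Set} {f : A → B} {xs : List A} → Unique (map f xs) →
                         ∀ {x y} → x ∈ xs → y ∈ xs → f x ≡ f y → x ≡ y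
Unique-map⇒∈-injective (_ ∷ _) (here refl) (here refl) _ = refl
Unique-map⇒∈-injective {f = f} (x≢ ∷ _) (here refl) (there y∈) fx≡fy =
  ⊥-elim (All.lookup x≢ (∈-map⁺ f y∈) fx≡fy)
Unique-map⇒∈-injective {f = f} (y≢ ∷ _) (there x∈) (here refl) fx≡fy =
  ⊥-elim (All.lookup y≢ (∈-map⁺ f x∈) (sym fx≡fy))
Unique-map⇒∈-injective (_ ∷ u) (there x∈) (there y∈) fx≡fy =
  Unique-map⇒∈-injective u x∈ y∈ fx≡fy

IsCoalgMorphism : (C D : PCoalg) → (Carrier C → Carrier D) → Set
IsCoalgMorphism C D h = ∀ x → str D (h x) ↭ map h (str C x)

module _ {C D : PCoalg} {h : Carrier C → Carrier D} (h-mor : IsCoalgMorphism C D h) where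

  lift-successor : ∀ {c y y′} → h c ≡ y → y′ ∈ str D y →
                   ∃ λ c′ → c′ ∈ str C c × h c′ ≡ y′
  lift-successor {c} refl y′∈ =
    let c′ , c′∈ , y′≡ = ∈-map⁻ h (∈-resp-↭ (h-mor c) y′∈) in c′ , c′∈ , sym y′≡

  section-isCoalgMorphism : (s : Carrier D → Carrier C) → (∀ y → h (s y) ≡ y) →
                            (∀ y → Unique (str D y)) →
                            (∀ {y y′} → y′ ∈ str D y → s y′ ∈ str C (s y)) →
                            IsCoalgMorphism D C s
  section-isCoalgMorphism s h∘s≡id D-unique s-successor y = begin
    str C (s y)                  ≡⟨ map-id-local (All.tabulate s∘h≡id) ⟨
    map (s ∘ h) (str C (s y))    ≡⟨ map-∘ (str C (s y)) ⟩
    map s (map h (str C (s y)))  ↭⟨ map⁺ s (↭-sym h-succ) ⟩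
    map s (str D y)              ∎
    where
    open PermutationReasoning

    h-succ : str D y ↭ map h (str C (s y))
    h-succ = subst (λ z → str D z ↭ map h (str C (s y))) (h∘s≡id y) (h-mor (s y))

    s∘h≡id : ∀ {c} → c ∈ str C (s y) → s (h c) ≡ c
    s∘h≡id {c} c∈ =
      Unique-map⇒∈-injective (Unique-resp-↭ (setoid _) (↭⇒↭ₛ h-succ) (D-unique y))
        (s-successor hc∈) c∈ (h∘s≡id (h c))
      where
      hc∈ : h c ∈ str D y
      hc∈ = ∈-resp-↭ (↭-sym h-succ) (∈-map⁺ h c∈)

module RootedPaths (G : Graph) (fb : FinitelyBranching G) where

  private
    Ē : PCoalg
    Ē = pathCoalg G fb

  edgesFrom : V G → List (E G)
  edgesFrom v = proj₁ (fb v)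

  edgesFrom-unique : ∀ v → Unique (edgesFrom v)
  edgesFrom-unique v = proj₁ (proj₂ (fb v))

  ∈edgesFrom⇒src : ∀ {v e} → e ∈ edgesFrom v → src G e ≡ v
  ∈edgesFrom⇒src {v} {e} = Equivalence.to (proj₂ (proj₂ (fb v)) e)

  src∈edgesFrom : ∀ e → e ∈ edgesFrom (src G e)
  src∈edgesFrom e = Equivalence.from (proj₂ (proj₂ (fb (src G e))) e) refl

  extend : ∀ {v} → Path G v → ∀ {e} → e ∈ edgesFrom v → RootedPath G
  extend p {e} e∈ = tgt G e , snoc e (subst (Path G) (sym (∈edgesFrom⇒src e∈)) p)

  lastEdge : RootedPath G → Maybe (E G)
  lastEdge (_ , ε)        = nothing
  lastEdge (_ , snoc e _) = just e

  parent : RootedPath G → Maybe (RootedPath G)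
  parent (_ , ε)        = nothing
  parent (_ , snoc e p) = just (src G e , p)

  -- The match on a proof of src G e ≡ src G e relies on K.
  extend-snoc : ∀ {e} (p : Path G (src G e)) (e∈ : e ∈ edgesFrom (src G e)) →
                extend p e∈ ≡ (tgt G e , snoc e p)
  extend-snoc {e} p e∈ with ∈edgesFrom⇒src e∈
  ... | refl = refl

  parent-extend : ∀ {v} (p : Path G v) {e} (e∈ : e ∈ edgesFrom v) → parent (extend p e∈) ≡ just (v , p)
  parent-extend p e∈ = cong just (Σ-≡,≡→≡ (src≡ , subst-subst-sym src≡))
    where src≡ = ∈edgesFrom⇒src e∈

  snoc∈d : ∀ {e} (p : Path G (src G e)) → (tgt G e , snoc e p) ∈ str Ē (src G e , p)
  snoc∈d {e} p = mapWith∈⁺ (extend p) (e , src∈edgesFrom e , sym (extend-snoc p (src∈edgesFrom e)))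

  ∈d⇒parent : ∀ {y q} → q ∈ str Ē y → parent q ≡ just y
  ∈d⇒parent {v , p} q∈ =
    let e , e∈ , q≡ = mapWith∈⁻ (edgesFrom v) (extend p) q∈
    in trans (cong parent q≡) (parent-extend p e∈)

  d-unique : ∀ y → Unique (str Ē y)
  d-unique (v , p) = Unique.map⁻ {f = lastEdge} lastEdges-unique
    where
    open ≡-Reasoning
    lastEdges : map just (edgesFrom v) ≡ map lastEdge (str Ē (v , p))
    lastEdges = begin
      map just (edgesFrom v)                          ≡⟨ mapWith∈≗map just (edgesFrom v) ⟨
      mapWith∈ (edgesFrom v) (λ {e} _ → just e)       ≡⟨ map-mapWith∈ (edgesFrom v) (extend p) lastEdge ⟨
      map lastEdge (str Ē (v , p))                    ∎
    lastEdges-unique : Unique (map lastEdge (str Ē (v , p)))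
    lastEdges-unique = subst Unique lastEdges (Unique.map⁺ just-injective (edgesFrom-unique v))

  module _ {C : PCoalg} {h : Carrier C → RootedPath G} (h-mor : IsPMorphism C Ē h) where

    lift : ∀ {v} (p : Path G v) → Σ (Carrier C) λ c → h c ≡ (v , p)
    lift ε          = pt C , proj₂ h-mor
    lift (snoc e p) =
      let c′ , _ , hc′≡ = lift-successor {C} {Ē} (proj₁ h-mor) (proj₂ (lift p)) (snoc∈d p) in c′ , hc′≡

    section : RootedPath G → Carrier C
    section (_ , p) = proj₁ (lift p)

    h∘section≡id : ∀ y → h (section y) ≡ y
    h∘section≡id (_ , p) = proj₂ (lift p)

    section-parent : ∀ {y} q → parent q ≡ just y → section q ∈ str C (section y)
    section-parent (_ , snoc e p) refl =
      proj₁ (proj₂ (lift-successor {C} {Ē} (proj₁ h-mor) (proj₂ (lift p)) (snoc∈d p)))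

    section-successor : ∀ {y q} → q ∈ str Ē y → section q ∈ str C (section y)
    section-successor q∈ = section-parent _ (∈d⇒parent q∈)

    section-isPMorphism : IsPMorphism Ē C section
    section-isPMorphism =
      section-isCoalgMorphism {C} {Ē} (proj₁ h-mor) section h∘section≡id d-unique section-successor ,
      refl

lemma5p12 : (G : Graph) (fb : FinitelyBranching G) → IsTree (pathCoalg G fb)
lemma5p12 G fb C h h-mor = section h-mor , section-isPMorphism h-mor , h∘section≡id h-mor
  where open RootedPaths G fb
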